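{- Let $\mathbf{L}\in\{\mathbf{K},\mathbf{K4}\}$. Then (1) $\mathbf{L}^{Horn,\Diamond}$ is strongly less expressive than $\mathbf{L}^{Horn}$, and (2) $\mathbf{L}^{Core,\Diamond}$ is strongly less expressive than $\mathbf{L}^{Core}$.
   Context: Fix a countable set $\mathcal P$ of propositional letters; Kripke models $M=(W,R,V)$ with $V:W\to2^{\mathcal P}$ and standard modal satisfaction. $\mathbf{K}$ is interpreted over all frames, $\mathbf{K4}$ over transitive frames. Positive literals: $\lambda ::= \top \mid p \mid \Diamond\lambda \mid \Box\lambda$. A clause is $\Box^s(\neg\lambda_1\vee\dots\vee\neg\lambda_n\vee\lambda_{n+1}\vee\dots\vee\lambda_{n+m})$ ($s,n,m\ge0$, $\Box^s$ = $s$ nested boxes); clausal-form formulas are finite conjunctions of clauses (literals count as clauses). $\mathbf{L}^{Horn}$: all clauses have $m\le1$; $\mathbf{L}^{Core}$: all clauses have $m\le1$ and $n+m\le2$; $\mathbf{L}^{Horn,\Diamond}$, $\mathbf{L}^{Core,\Diamond}$: additionally all positive literals are built without $\Box$ (the prefix $\Box^s$ of a clause is still allowed). All are interpreted over the frame class of $\mathbf{L}$. A model-extending translation from $\mathcal L_1$ to $\mathcal L_2$ (same frame class $\mathcal C$) is an effective map sending each $\mathcal L_1$-formula $\varphi$ over alphabet $\mathcal P_0$ to an $\mathcal L_2$-formula $\varphi'$ over $\mathcal P'\supseteq\mathcal P_0$ such that for every model $M$ over a frame in $\mathcal C$ and world $w$, $M,w\models\varphi$ iff the valuation of $M$ can be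 extended to $\mathcal P'$ giving $M'$ with $M',w\models\varphi'$. $\mathcal L_1$ is strongly less expressive than $\mathcal L_2$ if there is a model-extending translation from $\mathcal L_1$ to $\mathcal L_2$ but none from $\mathcal L_2$ to $\mathcal L_1$. -}

module Defs where

open import Data.Nat using (ℕ; zero; suc; _≤_; _+_)
open import Data.List using (List; []; _∷_; length)
open import Data.List.Relation.Unary.All using (All)
open import Data.List.Relation.Unary.Any using (Any)
open import Data.Product using (Σ; ∃; _×_; _,_)
open import Data.Sum using (_⊎_)
open import Data.Unit using (⊤)
open import Data.Empty using (⊥)
open import Relation.Nullary using (¬_)
open import Relation.Binary.PropositionalEquality using (_≡_)
open import Function.Bundles using (_⇔_)

data Lit : Set where
  top : Lit
  var : ℕ → Lit
  dia : Lit → Lit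
  box : Lit → Lit

-- A clause  □^s (¬λ₁ ∨ … ∨ ¬λₙ ∨ λₙ₊₁ ∨ … ∨ λₙ₊ₘ)
record Clause : Set where
  constructor clause
  field
    depth : ℕ
    negs  : List Lit
    poss  : List Lit
open Clause public

-- Clausal-form formula: a finite conjunction of clauses
CForm : Set
CForm = List Clause

data BoxFree : Lit → Set where
  top : BoxFree top
  var : ∀ p → BoxFree (var p)
  dia : ∀ {l} → BoxFree l → BoxFree (dia l)

HornClause : Clause → Set
HornClause C = length (poss C) ≤ 1

CoreClause : Clause → Set
CoreClause C = (length (poss C) ≤ 1) × (length (negs C) + length (poss C) ≤ 2)

DiaClause : Clause → Set
DiaClause C = All BoxFree (negs C) × All BoxFree (poss C)

Language : Set₁
Language = CForm → Set

Horn : Language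
Horn φ = All HornClause φ

Core : Language
Core φ = All CoreClause φ

HornDia : Language
HornDia φ = All (λ C → HornClause C × DiaClause C) φ

CoreDia : Language
CoreDia φ = All (λ C → CoreClause C × DiaClause C) φ

data OccL (p : ℕ) : Lit → Set where
  here : OccL p (var p)
  dia  : ∀ {l} → OccL p l → OccL p (dia l)
  box  : ∀ {l} → OccL p l → OccL p (box l)

OccC : ℕ → Clause → Set
OccC p C = Any (OccL p) (negs C) ⊎ Any (OccL p) (poss C)

Occurs : ℕ → CForm → Set
Occurs p φ = Any (OccC p) φ

record Frame : Set₁ where
  field
    W : Set
    R : W → W → Set
open Frame public

-- valuation V : W → 2^𝒫, subsets represented as predicates
Valuation : Frame → Set₁
Valuation F = W F → ℕ → Set

record Model : Set₁ where
  field
    frame : Frame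
    val   : Valuation frame
open Model public

module _ (F : Frame) (V : Valuation F) where

  satL : W F → Lit → Set
  satL w top     = ⊤
  satL w (var p) = V w p
  satL w (dia l) = ∃ λ v → R F w v × satL v l
  satL w (box l) = ∀ v → R F w v → satL v l

  satBody : W F → List Lit → List Lit → Set
  satBody w ns ps = Any (λ l → ¬ satL w l) ns ⊎ Any (satL w) ps

  satBoxes : ℕ → W F → List Lit → List Lit → Set
  satBoxes zero    w ns ps = satBody w ns ps
  satBoxes (suc s) w ns ps = ∀ v → R F w v → satBoxes s v ns ps

  satC : W F → Clause → Set
  satC w C = satBoxes (depth C) w (negs C) (poss C)

  satF : W F → CForm → Set
  satF w φ = All (satC w) φ

_,_⊨_ : (M : Model) → W (frame M) → CForm → Set
M , w ⊨ φ = satF (frame M) (val M) w φ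

-- Logics K and K4 via their frame classes

data Logic : Set where
  K K4 : Logic

Transitive : Frame → Set
Transitive F = ∀ {x y z} → R F x y → R F y z → R F x z

FrameClass : Logic → Frame → Set
FrameClass K  F = ⊤
FrameClass K4 F = Transitive F

ExtendsOn : {F : Frame} → CForm → Valuation F → Valuation F → Set
ExtendsOn {F} φ V V' = ∀ p → Occurs p φ → ∀ (w : W F) → (V' w p ⇔ V w p)

-- A model-extending translation from ℒ₁ to ℒ₂ over the frame class of L.
-- (Effectiveness is automatic: the map is an Agda function.)
record Translation (L : Logic) (ℒ₁ ℒ₂ : Language) : Set₁ where
  field
    tr      : (φ : CForm) → ℒ₁ φ → CForm
    tr-lang : (φ : CForm) (h : ℒ₁ φ) → ℒ₂ (tr φ h)
    tr-sound : (φ : CForm) (h : ℒ₁ φ) (F : Frame) → FrameClass L F →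
               (V : Valuation F) (w : W F) →
               satF F V w φ ⇔
               (Σ (Valuation F) λ V' → ExtendsOn {F} φ V V' × satF F V' w (tr φ h))

StronglyLessExpressive : Logic → Language → Language → Set₁
StronglyLessExpressive L ℒ₁ ℒ₂ = Translation L ℒ₁ ℒ₂ × ¬ Translation L ℒ₂ ℒ₁

-- Clauses of L^{Horn,◇} are preserved under direct products of pointed models: a box-free
-- positive literal holds at a pair of worlds iff it holds at both components, and a Horn
-- clause has at most one positive literal.  A model-extending translation transfers this
-- preservation back to the source language, since extended valuations can be multiplied.
-- The axiom □p → p, which is Core, is not preserved: it holds at an irreflexive point
-- satisfying p and at any reflexive point, but fails at their product, an irreflexive point
-- refuting p.  The translations from each ◇-fragment into the full fragment are the identity.
module Submission where

open import Defs
open import Data.Nat using (ℕ; zero; suc; _≤_; s≤s; z≤n)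
open import Data.List using ([]; _∷_; length)
open import Data.List.Relation.Unary.All as All using (All; []; _∷_)
open import Data.List.Relation.Unary.Any using (Any; here; there)
open import Data.Product using (_×_; _,_; proj₁; proj₂)
open import Data.Sum using (inj₁; inj₂)
open import Data.Unit using (⊤; tt)
open import Data.Empty using (⊥)
open import Relation.Nullary using (¬_)
open import Function.Bundles using (_⇔_; mk⇔; Equivalence)

open Equivalence

_,_⊩_ : (M : Model) → W (frame M) → Lit → Set
M , w ⊩ l = satL (frame M) (val M) w l

Any-zipAll : ∀ {A : Set} {P Q R : A → Set} {xs} →
             (∀ {x} → P x → Q x → R x) → All P xs → Any Q xs → Any R xs
Any-zipAll f (px ∷ _)   (here qx)  = here (f px qx)
Any-zipAll f (_  ∷ pxs) (there qx) = there (Any-zipAll f pxs qx)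

module _ {F : Frame} (V V' : Valuation F) where

  private
    Agree : ℕ → Set
    Agree p = ∀ w → V' w p ⇔ V w p

  satL-cong : ∀ l → (∀ {p} → OccL p l → Agree p) →
              ∀ w → satL F V' w l ⇔ satL F V w l
  satL-cong top     agree w = mk⇔ (λ _ → tt) (λ _ → tt)
  satL-cong (var p) agree w = agree here w
  satL-cong (dia l) agree w = mk⇔
    (λ (v , r , s) → v , r , to   (satL-cong l (λ o → agree (dia o)) v) s)
    (λ (v , r , s) → v , r , from (satL-cong l (λ o → agree (dia o)) v) s)
  satL-cong (box l) agree w = mk⇔
    (λ s v r → to   (satL-cong l (λ o → agree (box o)) v) (s v r))
    (λ s v r → from (satL-cong l (λ o → agree (box o)) v) (s v r))

  Any-satL-cong : (Φ : Set → Set) → (∀ {A B} → A ⇔ B → Φ A → Φ B) →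
                  ∀ ls → (∀ {p} → Any (OccL p) ls → Agree p) → ∀ w →
                  Any (λ l → Φ (satL F V' w l)) ls → Any (λ l → Φ (satL F V w l)) ls
  Any-satL-cong Φ transport (l ∷ ls) agree w (here x) =
    here (transport (satL-cong l (λ o → agree (here o)) w) x)
  Any-satL-cong Φ transport (l ∷ ls) agree w (there x) =
    there (Any-satL-cong Φ transport ls (λ o → agree (there o)) w x)

  satBoxes-cong : ∀ s ns ps → (∀ {p} → OccC p (clause s ns ps) → Agree p) →
                  ∀ w → satBoxes F V' s w ns ps → satBoxes F V s w ns ps
  satBoxes-cong zero ns ps agree w (inj₁ x) =
    inj₁ (Any-satL-cong ¬_ (λ e n s → n (from e s)) ns (λ o → agree (inj₁ o)) w x)
  satBoxes-cong zero ns ps agree w (inj₂ x) =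
    inj₂ (Any-satL-cong (λ A → A) to ps (λ o → agree (inj₂ o)) w x)
  satBoxes-cong (suc s) ns ps agree w h v r = satBoxes-cong s ns ps agree v (h v r)

  satF-ExtendsOn : ∀ φ → ExtendsOn {F} φ V V' → ∀ w → satF F V' w φ → satF F V w φ
  satF-ExtendsOn []      ext w []       = []
  satF-ExtendsOn (C ∷ φ) ext w (c ∷ cs) =
    satBoxes-cong (depth C) (negs C) (poss C) (λ o → ext _ (here o)) w c
      ∷ satF-ExtendsOn φ (λ p o → ext p (there o)) w cs

inclusion-translation : ∀ {L ℒ₁ ℒ₂} → (∀ φ → ℒ₁ φ → ℒ₂ φ) → Translation L ℒ₁ ℒ₂
inclusion-translation ℒ₁⊆ℒ₂ = record
  { tr       = λ φ _ → φ
  ; tr-lang  = ℒ₁⊆ℒ₂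
  ; tr-sound = λ φ _ F _ V w → mk⇔
      (λ s → V , (λ _ _ _ → mk⇔ (λ x → x) (λ x → x)) , s)
      (λ (V' , ext , s) → satF-ExtendsOn V V' φ ext w s)
  }

_⊗ᶠ_ : Frame → Frame → Frame
F₁ ⊗ᶠ F₂ = record
  { W = W F₁ × W F₂
  ; R = λ (a , b) (a' , b') → R F₁ a a' × R F₂ b b'
  }

_⊗_ : Model → Model → Model
M₁ ⊗ M₂ = record
  { frame = frame M₁ ⊗ᶠ frame M₂
  ; val   = λ (a , b) p → val M₁ a p × val M₂ b p
  }

FrameClass-⊗ᶠ : ∀ L {F₁ F₂} → FrameClass L F₁ → FrameClass L F₂ → FrameClass L (F₁ ⊗ᶠ F₂)
FrameClass-⊗ᶠ K  _  _  = tt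
FrameClass-⊗ᶠ K4 t₁ t₂ (r₁ , r₂) (s₁ , s₂) = t₁ r₁ s₁ , t₂ r₂ s₂

ExtendsOn-⊗ : ∀ {φ} (M₁ M₂ : Model) {V₁ V₂} →
              ExtendsOn {frame M₁} φ (val M₁) V₁ → ExtendsOn {frame M₂} φ (val M₂) V₂ →
              ExtendsOn {frame (M₁ ⊗ M₂)} φ (val (M₁ ⊗ M₂))
                (val (record M₁ { val = V₁ } ⊗ record M₂ { val = V₂ }))
ExtendsOn-⊗ M₁ M₂ ext₁ ext₂ p o (a , b) = mk⇔
  (λ (x , y) → to   (ext₁ p o a) x , to   (ext₂ p o b) y)
  (λ (x , y) → from (ext₁ p o a) x , from (ext₂ p o b) y)

module _ (M₁ M₂ : Model) where

  private
    M = M₁ ⊗ M₂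

  satL-⊗ : ∀ {l} → BoxFree l → ∀ a b → M , (a , b) ⊩ l ⇔ (M₁ , a ⊩ l × M₂ , b ⊩ l)
  satL-⊗ top     a b = mk⇔ (λ _ → tt , tt) (λ _ → tt)
  satL-⊗ (var p) a b = mk⇔ (λ x → x) (λ x → x)
  satL-⊗ (dia bf) a b = mk⇔
    (λ ((c , d) , (r₁ , r₂) , s) → let (s₁ , s₂) = to (satL-⊗ bf c d) s
                                   in (c , r₁ , s₁) , (d , r₂ , s₂))
    (λ ((c , r₁ , s₁) , (d , r₂ , s₂)) → (c , d) , (r₁ , r₂) , from (satL-⊗ bf c d) (s₁ , s₂))

  satBoxes-⊗ : ∀ s {ns ps} → All BoxFree ns → All BoxFree ps → length ps ≤ 1 → ∀ a b →
               satBoxes (frame M₁) (val M₁) s a ns ps → satBoxes (frame M₂) (val M₂) s b ns ps →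
               satBoxes (frame M) (val M) s (a , b) ns ps
  satBoxes-⊗ zero bfs _ _ a b (inj₁ n₁) _ =
    inj₁ (Any-zipAll (λ bf n s → n (proj₁ (to (satL-⊗ bf a b) s))) bfs n₁)
  satBoxes-⊗ zero bfs _ _ a b (inj₂ _) (inj₁ n₂) =
    inj₁ (Any-zipAll (λ bf n s → n (proj₂ (to (satL-⊗ bf a b) s))) bfs n₂)
  satBoxes-⊗ zero _ (bf ∷ []) _ a b (inj₂ (here s₁)) (inj₂ (here s₂)) =
    inj₂ (here (from (satL-⊗ bf a b) (s₁ , s₂)))
  satBoxes-⊗ zero _ (_ ∷ _ ∷ _) (s≤s ()) _ _ _ _
  satBoxes-⊗ (suc s) bfn bfp h a b h₁ h₂ (c , d) (r₁ , r₂) =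
    satBoxes-⊗ s bfn bfp h c d (h₁ c r₁) (h₂ d r₂)

  satF-⊗ : ∀ {φ} → HornDia φ → ∀ a b → M₁ , a ⊨ φ → M₂ , b ⊨ φ → M , (a , b) ⊨ φ
  satF-⊗ []                        a b []         []         = []
  satF-⊗ ((horn , bfn , bfp) ∷ hs) a b (c₁ ∷ cs₁) (c₂ ∷ cs₂) =
    satBoxes-⊗ _ bfn bfp horn a b c₁ c₂ ∷ satF-⊗ hs a b cs₁ cs₂

PreservedUnderProducts : Logic → CForm → Set₁
PreservedUnderProducts L φ =
  ∀ M₁ M₂ → FrameClass L (frame M₁) → FrameClass L (frame M₂) →
  ∀ a b → M₁ , a ⊨ φ → M₂ , b ⊨ φ → (M₁ ⊗ M₂) , (a , b) ⊨ φ

HornDia-preservedUnderProducts : ∀ L {φ} → HornDia φ → PreservedUnderProducts L φ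
HornDia-preservedUnderProducts L h M₁ M₂ _ _ = satF-⊗ M₁ M₂ h

Translation-reflects-preservedUnderProducts :
  ∀ {L ℒ₁ ℒ₂} → Translation L ℒ₁ ℒ₂ →
  (∀ ψ → ℒ₂ ψ → PreservedUnderProducts L ψ) → ∀ φ → ℒ₁ φ → PreservedUnderProducts L φ
Translation-reflects-preservedUnderProducts {L} T preserved φ h M₁ M₂ inL₁ inL₂ a b s₁ s₂ =
  let open Translation T
      (V₁ , ext₁ , s₁′) = to (tr-sound φ h (frame M₁) inL₁ (val M₁) a) s₁
      (V₂ , ext₂ , s₂′) = to (tr-sound φ h (frame M₂) inL₂ (val M₂) b) s₂
      M₁′ = record M₁ { val = V₁ }
      M₂′ = record M₂ { val = V₂ }
  in from (tr-sound φ h _ (FrameClass-⊗ᶠ L inL₁ inL₂) (val (M₁ ⊗ M₂)) (a , b))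
       (val (M₁′ ⊗ M₂′) , ExtendsOn-⊗ M₁ M₂ ext₁ ext₂ ,
        preserved _ (tr-lang φ h) M₁′ M₂′ inL₁ inL₂ a b s₁′ s₂′)

pointModel : (Access Truth : Set) → Model
pointModel A P = record
  { frame = record { W = ⊤ ; R = λ _ _ → A }
  ; val   = λ _ _ → P
  }

pointModel-inClass : ∀ L A P → FrameClass L (frame (pointModel A P))
pointModel-inClass K  A P = tt
pointModel-inClass K4 A P = λ r _ → r

axiomT : CForm
axiomT = clause 0 (box (var 0) ∷ []) (var 0 ∷ []) ∷ []

axiomT-core : Core axiomT
axiomT-core = (s≤s z≤n , s≤s (s≤s z≤n)) ∷ []

axiomT-not-preservedUnderProducts : ∀ L → ¬ PreservedUnderProducts L axiomT
axiomT-not-preservedUnderProducts L preserved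
  with preserved (pointModel ⊥ ⊤) (pointModel ⊤ ⊥)
         (pointModel-inClass L ⊥ ⊤) (pointModel-inClass L ⊤ ⊥) tt tt
         (inj₂ (here tt) ∷ []) (inj₁ (here (λ □p → □p tt tt)) ∷ [])
... | inj₁ (here ¬□p) ∷ [] = ¬□p (λ { _ (() , _) })
... | inj₂ (here (_ , ())) ∷ []

theorem3p8 : (L : Logic) →
    StronglyLessExpressive L HornDia Horn × StronglyLessExpressive L CoreDia Core
theorem3p8 L =
  (inclusion-translation (λ _ → All.map proj₁) , no-translation-from axiomT-horn (λ _ h → h)) ,
  (inclusion-translation (λ _ → All.map proj₁) ,
   no-translation-from axiomT-core (λ _ → All.map (λ ((horn , _) , boxFree) → horn , boxFree)))
  where
    axiomT-horn : Horn axiomT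
    axiomT-horn = All.map proj₁ axiomT-core

    no-translation-from : ∀ {ℒ₁ ℒ₂} → ℒ₁ axiomT → (∀ ψ → ℒ₂ ψ → HornDia ψ) →
                          ¬ Translation L ℒ₁ ℒ₂
    no-translation-from axiomT∈ℒ₁ ℒ₂⊆HornDia T =
      axiomT-not-preservedUnderProducts L
        (Translation-reflects-preservedUnderProducts T
          (λ ψ h → HornDia-preservedUnderProducts L (ℒ₂⊆HornDia ψ h)) axiomT axiomT∈ℒ₁)
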